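{- Let $(P,\le,*)$ be a relatively pseudocomplemented poset satisfying the Ascending Chain Condition, let $T(x,y,z):=\operatorname{Max}L\big((x*y)*z,(z*y)*x\big)$ for $x,y,z\in P$, and let $\Theta$ be a reflexive binary relation on $P$ which is compatible with the binary operators $\operatorname{Max}L$, $\operatorname{Min}U$ and with $*$. Then $\Theta$ is a congruence on $(P,\le,*)$.
   Context: For a poset $(P,\le)$ and $x,y\in P$ let $L(x,y)=\{z\in P\mid z\le x,\ z\le y\}$ and $U(x,y)=\{z\in P\mid x\le z,\ y\le z\}$; $\operatorname{Max}A$ and $\operatorname{Min}A$ denote the sets of maximal and minimal elements of $A\subseteq P$. A poset is relatively pseudocomplemented if for all $x,y\in P$ there exists a greatest element $z$ of $P$ such that every element of $L(x,z)$ is $\le y$; this $z$ is denoted $x*y$. A binary relation $R$ on $P$ is compatible with a map $Q\colon P^2\to 2^P$ if whenever $(a_1,b_1),(a_2,b_2)\in R$ there exist $a\in Q(a_1,a_2)$ and $b\in Q(b_1,b_2)$ with $(a,b)\in R$; it is compatible with the operation $*$ if $(a_1,b_1),(a_2,b_2)\in R$ imply $(a_1*a_2,b_1*b_2)\in R$. A congruence on $(P,\le,*)$ is an equivalence relation on $P$ compatible with $(x,y)\mapsto\operatorname{Max}L(x,y)$, $(x,y)\mapsto\operatorname{Min}U(x,y)$ and $*$. -}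

module Defs where

open import Level using (Level; _⊔_; suc)
open import Data.Product using (_×_; Σ; ∃; _,_)
open import Relation.Nullary using (¬_)
open import Relation.Binary.PropositionalEquality using (_≡_)
open import Relation.Binary.Structures using (IsPartialOrder; IsEquivalence)
open import Induction.WellFounded using (WellFounded)

module _ {a ℓ : Level} {P : Set a} (_≤_ : P → P → Set ℓ) where

  Subset : Set (a ⊔ suc (a ⊔ ℓ))
  Subset = P → Set (a ⊔ ℓ)

  L : P → P → Subset
  L x y z = Lift' (z ≤ x × z ≤ y)
    where
      Lift' : Set ℓ → Set (a ⊔ ℓ)
      Lift' A = Level.Lift a A

  U : P → P → Subset
  U x y z = Level.Lift a (x ≤ z × y ≤ z)

  Max : Subset → Subset
  Max A z = A z × (∀ w → A w → z ≤ w → w ≡ z)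

  Min : Subset → Subset
  Min A z = A z × (∀ w → A w → w ≤ z → w ≡ z)

  _<_ : P → P → Set (a ⊔ ℓ)
  x < y = x ≤ y × ¬ (x ≡ y)

  -- Ascending Chain Condition: there is no infinite strictly ascending
  -- chain, rendered constructively as well-foundedness of _>_.
  ACC : Set (a ⊔ ℓ)
  ACC = WellFounded (λ x y → y < x)

  IsRelPseudocomplement : P → P → P → Set (a ⊔ ℓ)
  IsRelPseudocomplement x y r =
    (∀ w → L x r w → w ≤ y) × (∀ z → (∀ w → L x z w → w ≤ y) → z ≤ r)

  IsRelativelyPseudocomplemented : (P → P → P) → Set (a ⊔ ℓ)
  IsRelativelyPseudocomplemented _*_ = ∀ x y → IsRelPseudocomplement x y (x * y)

  T : (P → P → P) → P → P → P → Subset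
  T _*_ x y z = Max (L ((x * y) * z) ((z * y) * x))

  module _ {θ : Level} where
    CompatibleWithMap : (P → P → Set θ) → (P → P → Subset) → Set (a ⊔ ℓ ⊔ θ)
    CompatibleWithMap R Q = ∀ {a₁ b₁ a₂ b₂} → R a₁ b₁ → R a₂ b₂ →
      Σ P (λ x → Σ P (λ y → Q a₁ a₂ x × Q b₁ b₂ y × R x y))

    CompatibleWithOp : (P → P → Set θ) → (P → P → P) → Set (a ⊔ θ)
    CompatibleWithOp R _*_ = ∀ {a₁ b₁ a₂ b₂} → R a₁ b₁ → R a₂ b₂ → R (a₁ * a₂) (b₁ * b₂)

    IsCongruence : (P → P → P) → (P → P → Set θ) → Set (a ⊔ ℓ ⊔ θ)
    IsCongruence _*_ R =
      IsEquivalence R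
      × CompatibleWithMap R (λ x y → Max (L x y))
      × CompatibleWithMap R (λ x y → Min (U x y))
      × CompatibleWithOp R _*_

{-# OPTIONS --safe #-}
-- T is a Mal'cev term: in a relatively pseudocomplemented poset x * x is the top element,
-- so (x * x) * y = y, and y ≤ (y * x) * x; hence T(x,x,y) = {y} and T(x,y,y) = {x}.
-- A reflexive relation compatible with Max L and * is compatible with T, and any
-- reflexive relation compatible with a Mal'cev term is symmetric and transitive.
module Submission where

open import Defs
open import Level using (Level; _⊔_; lift)
open import Data.Product using (_×_; _,_; Σ; proj₁; proj₂)
open import Relation.Binary.PropositionalEquality using (_≡_; sym; trans; subst; subst₂)
open import Relation.Binary.Structures using (IsPartialOrder; IsEquivalence)
open import Relation.Binary.Definitions using (Reflexive)

Compatible₃ : ∀ {a m θ} {P : Set a} → (P → P → Set θ) → (P → P → P → P → Set m) → Set (a ⊔ m ⊔ θ)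
Compatible₃ {P = P} Θ M = ∀ {x₁ x₂ y₁ y₂ z₁ z₂} → Θ x₁ x₂ → Θ y₁ y₂ → Θ z₁ z₂ →
  Σ P λ u → Σ P λ v → M x₁ y₁ z₁ u × M x₂ y₂ z₂ v × Θ u v

module Malcev {a m θ} {P : Set a} (M : P → P → P → P → Set m)
  (M-xxy : ∀ {x y u} → M x x y u → u ≡ y)
  (M-xyy : ∀ {x y u} → M x y y u → u ≡ x)
  {Θ : P → P → Set θ} (Θ-refl : Reflexive Θ) (Θ-compat : Compatible₃ Θ M) where

  Θ-sym : ∀ {x y} → Θ x y → Θ y x
  Θ-sym {x} {y} xy with Θ-compat (Θ-refl {x}) xy (Θ-refl {y})
  ... | u , v , Mxxy-u , Mxyy-v , uv = subst₂ Θ (M-xxy Mxxy-u) (M-xyy Mxyy-v) uv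

  Θ-trans : ∀ {x y z} → Θ x y → Θ y z → Θ x z
  Θ-trans {y = y} xy yz with Θ-compat xy (Θ-refl {y}) yz
  ... | u , v , Mxyy-u , Myyz-v , uv = subst₂ Θ (M-xyy Mxyy-u) (M-xxy Myyz-v) uv

  Θ-isEquivalence : IsEquivalence Θ
  Θ-isEquivalence = record { refl = Θ-refl ; sym = Θ-sym ; trans = Θ-trans }

module _ {a ℓ} {P : Set a} {_≤_ : P → P → Set ℓ} (≤-refl : Reflexive _≤_) where

  Max-L-≤ : ∀ {x y u} → x ≤ y → Max _≤_ (L _≤_ x y) u → u ≡ x
  Max-L-≤ {x} x≤y (lift (u≤x , _) , maximal) = sym (maximal x (lift (≤-refl , x≤y)) u≤x)

  Max-L-≥ : ∀ {x y u} → y ≤ x → Max _≤_ (L _≤_ x y) u → u ≡ y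
  Max-L-≥ {y = y} y≤x (lift (_ , u≤y) , maximal) = sym (maximal y (lift (y≤x , ≤-refl)) u≤y)

module RelativelyPseudocomplemented {a ℓ} {P : Set a} {_≤_ : P → P → Set ℓ} {_*_ : P → P → P}
  (po : IsPartialOrder _≡_ _≤_) (rpc : IsRelativelyPseudocomplemented _≤_ _*_) where

  open IsPartialOrder po using (antisym) renaming (refl to ≤-refl)

  y≤x*x : ∀ x y → y ≤ (x * x)
  y≤x*x x y = proj₂ (rpc x x) y (λ { _ (lift (w≤x , _)) → w≤x })

  [x*x]*y≡y : ∀ x y → ((x * x) * y) ≡ y
  [x*x]*y≡y x y = antisym
    (proj₁ (rpc (x * x) y) ((x * x) * y) (lift (y≤x*x x _ , ≤-refl)))
    (proj₂ (rpc (x * x) y) y (λ { _ (lift (_ , w≤y)) → w≤y }))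

  y≤[y*x]*x : ∀ x y → y ≤ ((y * x) * x)
  y≤[y*x]*x x y = proj₂ (rpc (y * x) x) y
    (λ { w (lift (w≤y*x , w≤y)) → proj₁ (rpc y x) w (lift (w≤y , w≤y*x)) })

  T-xxy : ∀ {x y u} → T _≤_ _*_ x x y u → u ≡ y
  T-xxy {x} {y} max = trans (Max-L-≤ ≤-refl [x*x]*y≤[y*x]*x max) ([x*x]*y≡y x y)
    where
    [x*x]*y≤[y*x]*x : ((x * x) * y) ≤ ((y * x) * x)
    [x*x]*y≤[y*x]*x = subst (_≤ ((y * x) * x)) (sym ([x*x]*y≡y x y)) (y≤[y*x]*x x y)

  T-xyy : ∀ {x y u} → T _≤_ _*_ x y y u → u ≡ x
  T-xyy {x} {y} max = trans (Max-L-≥ ≤-refl [y*y]*x≤[x*y]*y max) ([x*x]*y≡y y x)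
    where
    [y*y]*x≤[x*y]*y : ((y * y) * x) ≤ ((x * y) * y)
    [y*y]*x≤[x*y]*y = subst (_≤ ((x * y) * y)) (sym ([x*x]*y≡y y x)) (y≤[y*x]*x y x)

T-compatible : ∀ {a ℓ θ} {P : Set a} {_≤_ : P → P → Set ℓ} {_*_ : P → P → P} {Θ : P → P → Set θ}
  → CompatibleWithMap _≤_ Θ (λ x y → Max _≤_ (L _≤_ x y))
  → CompatibleWithOp _≤_ Θ _*_
  → Compatible₃ Θ (T _≤_ _*_)
T-compatible Θ-MaxL Θ-* x y z = Θ-MaxL (Θ-* (Θ-* x y) z) (Θ-* (Θ-* z y) x)

theorem4p6 : {a ℓ θ : Level} {P : Set a} (_≤_ : P → P → Set ℓ) (_*_ : P → P → P)
    → IsPartialOrder _≡_ _≤_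
    → IsRelativelyPseudocomplemented _≤_ _*_
    → ACC _≤_
    → (Θ : P → P → Set θ)
    → Reflexive Θ
    → CompatibleWithMap _≤_ Θ (λ x y → Max _≤_ (L _≤_ x y))
    → CompatibleWithMap _≤_ Θ (λ x y → Min _≤_ (U _≤_ x y))
    → CompatibleWithOp _≤_ Θ _*_
    → IsCongruence _≤_ _*_ Θ
theorem4p6 _≤_ _*_ po rpc _ Θ Θ-refl Θ-MaxL Θ-MinU Θ-* =
  Θ-isEquivalence , Θ-MaxL , Θ-MinU , Θ-*
  where
  open RelativelyPseudocomplemented po rpc using (T-xxy; T-xyy)
  open Malcev (T _≤_ _*_) T-xxy T-xyy Θ-refl (T-compatible Θ-MaxL Θ-*)
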